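{- Let $\mathcal{G}$ be a hereditary class of graphs and $r\ge 0$ a fixed integer. If $\mathcal{G}$ has a finite set of forbidden induced subgraphs, then so does its $r$-vertex-apex class.
   Context: All graphs are simple, finite and undirected. A class of graphs is hereditary if it is closed under taking induced subgraphs; a forbidden induced subgraph for it is a graph not in the class all of whose proper induced subgraphs are in the class. The $r$-vertex-apex class of $\mathcal{G}$ is the class of graphs $G$ such that a graph in $\mathcal{G}$ can be obtained from $G$ by deleting at most $r$ vertices. -}

module Defs where

open import Data.Nat using (ℕ; _+_; _<_; _≤_)
open import Data.Fin using (Fin)
open import Data.Bool using (Bool; false)
open import Data.List using (List)
open import Data.List.Relation.Unary.Any using (Any)
open import Data.Product using (Σ; _×_; ∃)
open import Relation.Nullary using (¬_)
open import Relation.Binary.PropositionalEquality using (_≡_)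
open import Function.Definitions using (Injective)

record Graph : Set where
  field
    n      : ℕ
    adj    : Fin n → Fin n → Bool
    sym    : ∀ i j → adj i j ≡ adj j i
    irrefl : ∀ i → adj i i ≡ false
open Graph public

record _≤ind_ (H G : Graph) : Set where
  field
    emb    : Fin (n H) → Fin (n G)
    inj    : Injective _≡_ _≡_ emb
    adj-eq : ∀ i j → adj H i j ≡ adj G (emb i) (emb j)

record _≅_ (G H : Graph) : Set where
  field
    to      : Fin (n G) → Fin (n H)
    from    : Fin (n H) → Fin (n G)
    from∘to : ∀ i → from (to i) ≡ i
    to∘from : ∀ j → to (from j) ≡ j
    adj-eq  : ∀ i j → adj G i j ≡ adj H (to i) (to j)

GraphClass : Set₁
GraphClass = Graph → Set

Hereditary : GraphClass → Set
Hereditary 𝒢 = ∀ {H G} → H ≤ind G → 𝒢 G → 𝒢 H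

_<ind_ : Graph → Graph → Set
H <ind G = (H ≤ind G) × (n H < n G)

Forbidden : GraphClass → Graph → Set
Forbidden 𝒢 F = ¬ 𝒢 F × (∀ H → H <ind F → 𝒢 H)

-- The set of forbidden induced subgraphs of 𝒢 is finite (up to isomorphism):
-- there is a finite list containing a copy of every forbidden induced subgraph.
HasFiniteForbidden : GraphClass → Set
HasFiniteForbidden 𝒢 =
  Σ (List Graph) λ L → ∀ F → Forbidden 𝒢 F → Any (λ H → F ≅ H) L

-- r-vertex-apex class: G such that deleting at most r vertices yields a
-- graph in 𝒢 (the remaining graph is an induced subgraph H of G with
-- |V(G)| ≤ |V(H)| + r).
Apex : ℕ → GraphClass → GraphClass
Apex r 𝒢 G = Σ Graph λ H → 𝒢 H × (H ≤ind G) × (n G ≤ n H + r)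

{-# OPTIONS --safe #-}
module Submission where

-- Let m bound the number of vertices of the forbidden induced subgraphs of 𝒢.  A graph outside
-- 𝒢 has a minimal induced subgraph outside 𝒢; it is forbidden, so it has at most m vertices.
-- By induction on r, every graph G outside the r-vertex-apex class has an induced subgraph on
-- at most f r vertices outside that class, where f 0 = m and f (r + 1) = m + m · f r: take
-- such a subgraph Y for 𝒢 and, for every vertex v of Y, one H v for the r-apex class inside
-- G - v.  The union U of Y and all H v is not (r + 1)-apex: deleting vertices from U so as to
-- land in 𝒢 must delete some v ∈ Y, which does not lie in H v, so the same deletions take H v
-- into 𝒢 with at most r of them inside H v.  Hence every forbidden graph of the r-apex class has
-- at most f r vertices, and graphs with at most f r vertices are finitely many up to isomorphism.
-- Membership in 𝒢 need not be decidable, so these small subgraphs are only obtained under a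
-- double negation; that suffices because the final bound on the number of vertices is decidable.

open import Defs
open import Data.Bool using (Bool; true; false; _∧_; if_then_else_)
open import Data.Bool.Properties using (∧-idem; ∧-comm)
open import Data.Fin using (Fin; zero; suc; _≟_)
open import Data.Fin.Properties using (suc-injective; injective⇒≤; any?; sequence)
open import Data.Fin.Subset
  using (Subset; inside; outside; _∈_; _∉_; _⊆_; _⊂_; _∪_; _∩_; _-_; ⁅_⁆; ⊥; ⊤; ∣_∣)
open import Data.Fin.Subset.Properties
  using ( _∈?_; drop-there; out⊆; s⊆s; ⊆-refl; ⊆-trans; ∉⊥; ∣⊥∣≡0; ∣⊤∣≡n; x∈⁅x⁆; ∣⁅x⁆∣≡1
        ; p⊆q⇒∣p∣≤∣q∣; p⊂q⇒∣p∣<∣q∣; p⊆p∪q; q⊆p∪q; x∈p∪q⁺; x∈p∪q⁻; p∩q⊆p; p∩q⊆q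
        ; p─q⊆p; x∈p∧x≢y⇒x∈p-y; x∈p⇒p-x⊂p )
open import Data.Fin.Subset.Induction using (⊂-wellFounded; Acc; acc)
open import Data.List using (List; []; _∷_; map; concatMap; upTo; cartesianProductWith)
open import Data.List.Extrema.Nat using (max; v≤max⁺)
open import Data.List.Membership.Propositional using (lose) renaming (_∈_ to _∈ₗ_)
open import Data.List.Membership.Propositional.Properties using (∈-cartesianProductWith⁺; ∈-upTo⁺)
open import Data.List.Relation.Unary.Any as Any using (Any; here; there)
open import Data.List.Relation.Unary.Any.Properties using (map⁺; concat⁺)
open import Data.Nat using (ℕ; zero; suc; _+_; _*_; _≤_; _≤?_; s≤s)
open import Data.Nat.Properties
  using ( ≤-reflexive; ≤-trans; ≤-pred; ≤-<-trans; <⇒≱; ≰⇒>; m≤m+n; m≤n+m; +-comm; +-assoc; +-suc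
        ; +-identityʳ; +-mono-≤; +-monoˡ-≤; +-monoʳ-≤; +-cancelʳ-≤; *-monoˡ-≤; module ≤-Reasoning )
open import Data.Product using (∃; _×_; _,_; proj₁; proj₂)
open import Data.Sum using (_⊎_; inj₁; inj₂; [_,_]′)
open import Data.Vec using (Vec; []; _∷_; lookup; tabulate; here; there)
open import Data.Vec.Properties using (lookup∘tabulate; []=⇒lookup; lookup⇒[]=)
open import Effect.Monad using (RawMonad)
open import Function using (_∘_; id; case_of_)
open import Function.Definitions using (Injective)
open import Level using (0ℓ)
open import Relation.Nullary using (¬_; yes; no; does; ¬?)
open import Relation.Nullary.Decidable
  using (_×-dec_; decidable-stable; dec-true; dec-false; ¬¬-excluded-middle)
open import Relation.Nullary.Negation using (¬¬-Monad; ¬¬-map; contradiction)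
open import Relation.Binary.PropositionalEquality as ≡ using (_≡_; refl; cong; cong₂; subst)

open RawMonad (¬¬-Monad {a = 0ℓ}) using (rawApplicative; pure; _>>=_)

private
  variable
    d d′ k m r : ℕ
    x v : Fin d
    p q u X Y : Subset d
    𝒫 : Subset d → Set
    G H K : Graph
    𝒢 : GraphClass

-- Counting subsets of a finite set

∣p∩q∣+∣p∪q∣≡∣p∣+∣q∣ : ∀ (p q : Subset d) → ∣ p ∩ q ∣ + ∣ p ∪ q ∣ ≡ ∣ p ∣ + ∣ q ∣
∣p∩q∣+∣p∪q∣≡∣p∣+∣q∣ [] [] = refl
∣p∩q∣+∣p∪q∣≡∣p∣+∣q∣ (outside ∷ p) (outside ∷ q) = ∣p∩q∣+∣p∪q∣≡∣p∣+∣q∣ p q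
∣p∩q∣+∣p∪q∣≡∣p∣+∣q∣ (inside ∷ p) (outside ∷ q) =
  ≡.trans (+-suc ∣ p ∩ q ∣ ∣ p ∪ q ∣) (cong suc (∣p∩q∣+∣p∪q∣≡∣p∣+∣q∣ p q))
∣p∩q∣+∣p∪q∣≡∣p∣+∣q∣ (outside ∷ p) (inside ∷ q) =
  ≡.trans (+-suc ∣ p ∩ q ∣ ∣ p ∪ q ∣)
          (≡.trans (cong suc (∣p∩q∣+∣p∪q∣≡∣p∣+∣q∣ p q)) (≡.sym (+-suc ∣ p ∣ ∣ q ∣)))
∣p∩q∣+∣p∪q∣≡∣p∣+∣q∣ (inside ∷ p) (inside ∷ q) =
  cong suc (≡.trans (+-suc ∣ p ∩ q ∣ ∣ p ∪ q ∣)
                    (≡.trans (cong suc (∣p∩q∣+∣p∪q∣≡∣p∣+∣q∣ p q)) (≡.sym (+-suc ∣ p ∣ ∣ q ∣))))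

∣p∪q∣≤∣p∣+∣q∣ : ∀ (p q : Subset d) → ∣ p ∪ q ∣ ≤ ∣ p ∣ + ∣ q ∣
∣p∪q∣≤∣p∣+∣q∣ p q = subst (∣ p ∪ q ∣ ≤_) (∣p∩q∣+∣p∪q∣≡∣p∣+∣q∣ p q) (m≤n+m ∣ p ∪ q ∣ ∣ p ∩ q ∣)

∣p∪q∣≤∣q∣+k⇒∣p∣≤∣p∩q∣+k : ∀ (p q : Subset d) → ∣ p ∪ q ∣ ≤ ∣ q ∣ + k → ∣ p ∣ ≤ ∣ p ∩ q ∣ + k
∣p∪q∣≤∣q∣+k⇒∣p∣≤∣p∩q∣+k {k = k} p q ∣p∪q∣≤ = +-cancelʳ-≤ ∣ q ∣ ∣ p ∣ (∣ p ∩ q ∣ + k) (begin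
  ∣ p ∣ + ∣ q ∣              ≡⟨ ∣p∩q∣+∣p∪q∣≡∣p∣+∣q∣ p q ⟨
  ∣ p ∩ q ∣ + ∣ p ∪ q ∣      ≤⟨ +-monoʳ-≤ ∣ p ∩ q ∣ ∣p∪q∣≤ ⟩
  ∣ p ∩ q ∣ + (∣ q ∣ + k)    ≡⟨ cong (∣ p ∩ q ∣ +_) (+-comm ∣ q ∣ k) ⟩
  ∣ p ∩ q ∣ + (k + ∣ q ∣)    ≡⟨ +-assoc (∣ p ∩ q ∣) k (∣ q ∣) ⟨
  ∣ p ∩ q ∣ + k + ∣ q ∣      ∎)
  where open ≤-Reasoning

∪-least : p ⊆ u → q ⊆ u → p ∪ q ⊆ u
∪-least {p = p} {q = q} p⊆u q⊆u = [ p⊆u , q⊆u ]′ ∘ x∈p∪q⁻ p q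

p⊆[p-x]∪⁅x⁆ : ∀ (p : Subset d) x → p ⊆ (p - x) ∪ ⁅ x ⁆
p⊆[p-x]∪⁅x⁆ p x {y} y∈p with y ≟ x
... | yes refl = x∈p∪q⁺ (inj₂ (x∈⁅x⁆ x))
... | no y≢x   = x∈p∪q⁺ (inj₁ (x∈p∧x≢y⇒x∈p-y y∈p y≢x))

∣p∣≤1+∣p-x∣ : ∀ (p : Subset d) x → ∣ p ∣ ≤ suc ∣ p - x ∣
∣p∣≤1+∣p-x∣ p x = begin
  ∣ p ∣                   ≤⟨ p⊆q⇒∣p∣≤∣q∣ (p⊆[p-x]∪⁅x⁆ p x) ⟩
  ∣ (p - x) ∪ ⁅ x ⁆ ∣     ≤⟨ ∣p∪q∣≤∣p∣+∣q∣ (p - x) ⁅ x ⁆ ⟩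
  ∣ p - x ∣ + ∣ ⁅ x ⁆ ∣   ≡⟨ cong (∣ p - x ∣ +_) (∣⁅x⁆∣≡1 x) ⟩
  ∣ p - x ∣ + 1           ≡⟨ +-comm ∣ p - x ∣ 1 ⟩
  suc ∣ p - x ∣           ∎
  where open ≤-Reasoning

x∉p-x : ∀ (p : Subset d) x → x ∉ p - x
x∉p-x (s ∷ p) zero    ()
x∉p-x (s ∷ p) (suc x) (there x∈p-x) = x∉p-x p x x∈p-x

⊆⊎∃∉ : ∀ (p q : Subset d) → p ⊆ q ⊎ ∃ λ x → x ∈ p × x ∉ q
⊆⊎∃∉ [] [] = inj₁ λ ()
⊆⊎∃∉ (s ∷ p) (t ∷ q) with ⊆⊎∃∉ p q
... | inj₂ (x , x∈p , x∉q) = inj₂ (suc x , there x∈p , x∉q ∘ drop-there)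
⊆⊎∃∉ (outside ∷ p) (t       ∷ q) | inj₁ p⊆q = inj₁ (out⊆ p⊆q)
⊆⊎∃∉ (inside  ∷ p) (inside  ∷ q) | inj₁ p⊆q = inj₁ (s⊆s p⊆q)
⊆⊎∃∉ (inside  ∷ p) (outside ∷ q) | inj₁ _   = inj₂ (zero , here , λ ())

⋃[_]_ : Subset d′ → (Fin d′ → Subset d) → Subset d
⋃[ [] ]          H = ⊥
⋃[ inside  ∷ Y ] H = H zero ∪ ⋃[ Y ] (H ∘ suc)
⋃[ outside ∷ Y ] H = ⋃[ Y ] (H ∘ suc)

⊆-⋃[] : ∀ (Y : Subset d′) (H : Fin d′ → Subset d) → x ∈ Y → H x ⊆ ⋃[ Y ] H
⊆-⋃[] (inside  ∷ Y) H here        = p⊆p∪q _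
⊆-⋃[] (inside  ∷ Y) H (there x∈Y) = q⊆p∪q (H zero) _ ∘ ⊆-⋃[] Y (H ∘ suc) x∈Y
⊆-⋃[] (outside ∷ Y) H (there x∈Y) = ⊆-⋃[] Y (H ∘ suc) x∈Y

⋃[]-least : ∀ (Y : Subset d′) (H : Fin d′ → Subset d) → (∀ {x} → x ∈ Y → H x ⊆ u) → ⋃[ Y ] H ⊆ u
⋃[]-least []            H H⊆u x∈⊥ = contradiction x∈⊥ ∉⊥
⋃[]-least (inside  ∷ Y) H H⊆u = ∪-least (H⊆u here) (⋃[]-least Y (H ∘ suc) (H⊆u ∘ there))
⋃[]-least (outside ∷ Y) H H⊆u = ⋃[]-least Y (H ∘ suc) (H⊆u ∘ there)

∣⋃[Y]H∣≤∣Y∣*k : ∀ (Y : Subset d′) (H : Fin d′ → Subset d) → (∀ {x} → x ∈ Y → ∣ H x ∣ ≤ k) →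
                ∣ ⋃[ Y ] H ∣ ≤ ∣ Y ∣ * k
∣⋃[Y]H∣≤∣Y∣*k {d = d} [] H _ = ≤-reflexive (∣⊥∣≡0 d)
∣⋃[Y]H∣≤∣Y∣*k (inside ∷ Y) H ∣H∣≤k =
  ≤-trans (∣p∪q∣≤∣p∣+∣q∣ (H zero) _) (+-mono-≤ (∣H∣≤k here) (∣⋃[Y]H∣≤∣Y∣*k Y (H ∘ suc) (∣H∣≤k ∘ there)))
∣⋃[Y]H∣≤∣Y∣*k (outside ∷ Y) H ∣H∣≤k = ∣⋃[Y]H∣≤∣Y∣*k Y (H ∘ suc) (∣H∣≤k ∘ there)

-- Small obstructions in set systems

DownClosed : (Subset d → Set) → Set
DownClosed 𝒫 = ∀ {X Y} → Y ⊆ X → 𝒫 X → 𝒫 Y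

record Obstruction (b : ℕ) (𝒫 : Subset d → Set) (X : Subset d) : Set where
  constructor obstruction
  field
    witness    : Subset d
    witness⊆   : witness ⊆ X
    ∣witness∣≤ : ∣ witness ∣ ≤ b
    witness∉   : ¬ 𝒫 witness

SmallObstructions : ℕ → (Subset d → Set) → Set
SmallObstructions b 𝒫 = ∀ X → ¬ 𝒫 X → ¬ ¬ Obstruction b 𝒫 X

MinimalCounterexample : (Subset d → Set) → Subset d → Set
MinimalCounterexample 𝒫 X = ∃ λ Y → Y ⊆ X × ¬ 𝒫 Y × (∀ {v} → v ∈ Y → 𝒫 (Y - v))

minimal-counterexample : ∀ X → ¬ 𝒫 X → ¬ ¬ MinimalCounterexample 𝒫 X
minimal-counterexample {𝒫 = 𝒫} X = go X (⊂-wellFounded X)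
  where
  go : ∀ X → Acc _⊂_ X → ¬ 𝒫 X → ¬ ¬ MinimalCounterexample 𝒫 X
  go X (acc smaller) ¬𝒫X = do
    decide ← sequence rawApplicative (λ v → ¬¬-excluded-middle {A = 𝒫 (X - v)})
    case any? (λ v → v ∈? X ×-dec ¬? (decide v)) of λ where
      (yes (v , v∈X , ¬𝒫[X-v])) →
        ¬¬-map (λ (Y , Y⊆X-v , minimal) → Y , (λ {_} → ⊆-trans Y⊆X-v (p─q⊆p X ⁅ v ⁆)) , minimal)
               (go (X - v) (smaller (x∈p⇒p-x⊂p v∈X)) ¬𝒫[X-v])
      (no none) →
        pure (X , (λ {_} → ⊆-refl) , ¬𝒫X ,
              λ {v} v∈X → decidable-stable (decide v) (λ ¬𝒫[X-v] → none (v , v∈X , ¬𝒫[X-v])))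

Apexₛ : ℕ → (Subset d → Set) → Subset d → Set
Apexₛ r 𝒫 X = ∃ λ Z → Z ⊆ X × 𝒫 Z × ∣ X ∣ ≤ ∣ Z ∣ + r

⇒Apexₛ : 𝒫 X → Apexₛ r 𝒫 X
⇒Apexₛ {X = X} {r = r} 𝒫X = X , (λ {_} → ⊆-refl) , 𝒫X , m≤m+n ∣ X ∣ r

Apexₛ-zero : DownClosed 𝒫 → Apexₛ 0 𝒫 X → 𝒫 X
Apexₛ-zero {X = X} down (Z , Z⊆X , 𝒫Z , ∣X∣≤∣Z∣+0) with ⊆⊎∃∉ X Z
... | inj₁ X⊆Z = down X⊆Z 𝒫Z
... | inj₂ (v , v∈X , v∉Z) =
  contradiction (subst (∣ X ∣ ≤_) (+-identityʳ ∣ Z ∣) ∣X∣≤∣Z∣+0) (<⇒≱ (p⊂q⇒∣p∣<∣q∣ (Z⊆X , v , v∈X , v∉Z)))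

Apexₛ-remove : Apexₛ r 𝒫 (X - v) → Apexₛ (suc r) 𝒫 X
Apexₛ-remove {r = r} {X = X} {v = v} (Z , Z⊆X-v , 𝒫Z , ∣X-v∣≤) =
  Z , (λ {_} → p─q⊆p X ⁅ v ⁆ ∘ Z⊆X-v) , 𝒫Z , (begin
    ∣ X ∣             ≤⟨ ∣p∣≤1+∣p-x∣ X v ⟩
    suc ∣ X - v ∣     ≤⟨ +-monoʳ-≤ 1 ∣X-v∣≤ ⟩
    suc (∣ Z ∣ + r)   ≡⟨ +-suc ∣ Z ∣ r ⟨
    ∣ Z ∣ + suc r     ∎)
  where open ≤-Reasoning

-- A set K witnessing that U is (r + 1)-apex misses some v ∈ Y, since 𝒫 Y fails; as v ∉ H v,
-- the set H v ∩ K then witnesses that H v is r-apex.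
¬Apexₛ-∪⋃ : {H : Fin d → Subset d} → DownClosed 𝒫 → ¬ 𝒫 Y →
            (∀ {v} → v ∈ Y → v ∉ H v) → (∀ {v} → v ∈ Y → ¬ Apexₛ r 𝒫 (H v)) →
            ¬ Apexₛ (suc r) 𝒫 (Y ∪ ⋃[ Y ] H)
¬Apexₛ-∪⋃ {Y = Y} {r = r} {H = H} down ¬𝒫Y v∉H ¬ApexH (K , K⊆U , 𝒫K , ∣U∣≤) with ⊆⊎∃∉ Y K
... | inj₁ Y⊆K = ¬𝒫Y (down Y⊆K 𝒫K)
... | inj₂ (v , v∈Y , v∉K) = ¬ApexH v∈Y (H v ∩ K , p∩q⊆p (H v) K , down (p∩q⊆q (H v) K) 𝒫K , ∣H∣≤∣H∩K∣+r)
  where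
  U = Y ∪ ⋃[ Y ] H
  H∪K⊂U : H v ∪ K ⊂ U
  H∪K⊂U = ∪-least (q⊆p∪q Y _ ∘ ⊆-⋃[] Y H v∈Y) K⊆U , v , p⊆p∪q _ v∈Y , [ v∉H v∈Y , v∉K ]′ ∘ x∈p∪q⁻ (H v) K
  ∣H∣≤∣H∩K∣+r : ∣ H v ∣ ≤ ∣ H v ∩ K ∣ + r
  ∣H∣≤∣H∩K∣+r = ∣p∪q∣≤∣q∣+k⇒∣p∣≤∣p∩q∣+k (H v) K
    (≤-pred (≤-trans (p⊂q⇒∣p∣<∣q∣ H∪K⊂U) (subst (∣ U ∣ ≤_) (+-suc ∣ K ∣ r) ∣U∣≤)))

apex-zero-obstructions : DownClosed 𝒫 → SmallObstructions m 𝒫 → SmallObstructions m (Apexₛ 0 𝒫)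
apex-zero-obstructions {𝒫 = 𝒫} {m = m} down small X ¬ApexX = ¬¬-map tighten (small X (¬ApexX ∘ ⇒Apexₛ))
  where
  tighten : Obstruction m 𝒫 X → Obstruction m (Apexₛ 0 𝒫) X
  tighten (obstruction Y Y⊆X ∣Y∣≤m ¬𝒫Y) = obstruction Y Y⊆X ∣Y∣≤m (¬𝒫Y ∘ Apexₛ-zero down)

apex-suc-obstructions : DownClosed 𝒫 → SmallObstructions m 𝒫 → SmallObstructions k (Apexₛ r 𝒫) →
                        SmallObstructions (m + m * k) (Apexₛ (suc r) 𝒫)
apex-suc-obstructions {𝒫 = 𝒫} {m = m} {k = k} {r = r} down small smallᵣ X ¬ApexX = do
  Y ← small X (¬ApexX ∘ ⇒Apexₛ)
  H ← sequence rawApplicative (λ v → smallᵣ (X - v) (¬ApexX ∘ Apexₛ-remove))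
  pure (combine Y H)
  where
  open Obstruction
  combine : Obstruction m 𝒫 X → (∀ v → Obstruction k (Apexₛ r 𝒫) (X - v)) →
            Obstruction (m + m * k) (Apexₛ (suc r) 𝒫) X
  combine (obstruction Y Y⊆X ∣Y∣≤m ¬𝒫Y) H =
    obstruction (Y ∪ ⋃[ Y ] Hs) U⊆X ∣U∣≤
      (¬Apexₛ-∪⋃ down ¬𝒫Y (λ {v} _ → x∉p-x X v ∘ witness⊆ (H v)) (λ {v} _ → witness∉ (H v)))
    where
    Hs : Fin _ → Subset _
    Hs = witness ∘ H
    U⊆X : Y ∪ ⋃[ Y ] Hs ⊆ X
    U⊆X = ∪-least Y⊆X (⋃[]-least Y Hs (λ {v} _ → p─q⊆p X ⁅ v ⁆ ∘ witness⊆ (H v)))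
    ∣U∣≤ : ∣ Y ∪ ⋃[ Y ] Hs ∣ ≤ m + m * k
    ∣U∣≤ = begin
      ∣ Y ∪ ⋃[ Y ] Hs ∣       ≤⟨ ∣p∪q∣≤∣p∣+∣q∣ Y (⋃[ Y ] Hs) ⟩
      ∣ Y ∣ + ∣ ⋃[ Y ] Hs ∣   ≤⟨ +-monoʳ-≤ ∣ Y ∣ (∣⋃[Y]H∣≤∣Y∣*k Y Hs (λ {v} _ → ∣witness∣≤ (H v))) ⟩
      ∣ Y ∣ + ∣ Y ∣ * k       ≤⟨ +-mono-≤ ∣Y∣≤m (*-monoˡ-≤ k ∣Y∣≤m) ⟩
      m + m * k               ∎
      where open ≤-Reasoning

apexBound : ℕ → ℕ → ℕ
apexBound m zero    = m
apexBound m (suc r) = m + m * apexBound m r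

apex-obstructions : DownClosed 𝒫 → SmallObstructions m 𝒫 → ∀ r → SmallObstructions (apexBound m r) (Apexₛ r 𝒫)
apex-obstructions down small zero    = apex-zero-obstructions down small
apex-obstructions down small (suc r) = apex-suc-obstructions down small (apex-obstructions down small r)

-- Induced subgraphs

enumerate : (p : Subset d) → Fin ∣ p ∣ → Fin d
enumerate (inside ∷ p) zero = zero
enumerate (inside ∷ p) (suc i) = suc (enumerate p i)
enumerate (outside ∷ p) i = suc (enumerate p i)

enumerate-injective : ∀ (p : Subset d) → Injective _≡_ _≡_ (enumerate p)
enumerate-injective (inside ∷ p) {zero} {zero} _ = refl
enumerate-injective (inside ∷ p) {zero} {suc j} ()
enumerate-injective (inside ∷ p) {suc i} {zero} ()
enumerate-injective (inside ∷ p) {suc i} {suc j} eq = cong suc (enumerate-injective p (suc-injective eq))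
enumerate-injective (outside ∷ p) eq = enumerate-injective p (suc-injective eq)

enumerate-∈ : ∀ (p : Subset d) i → enumerate p i ∈ p
enumerate-∈ (inside ∷ p) zero = here
enumerate-∈ (inside ∷ p) (suc i) = there (enumerate-∈ p i)
enumerate-∈ (outside ∷ p) i = there (enumerate-∈ p i)

index : ∀ {p : Subset d} {x} → x ∈ p → Fin ∣ p ∣
index here = zero
index {p = inside ∷ p} (there x∈p) = suc (index x∈p)
index {p = outside ∷ p} (there x∈p) = index x∈p

enumerate-index : ∀ {p : Subset d} {x} (x∈p : x ∈ p) → enumerate p (index x∈p) ≡ x
enumerate-index here = refl
enumerate-index {p = inside ∷ p} (there x∈p) = cong suc (enumerate-index x∈p)
enumerate-index {p = outside ∷ p} (there x∈p) = cong suc (enumerate-index x∈p)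

infix 25 _[_]

_[_] : (G : Graph) → Subset (n G) → Graph
G [ p ] = record
  { n      = ∣ p ∣
  ; adj    = λ i j → adj G (enumerate p i) (enumerate p j)
  ; sym    = λ i j → sym G (enumerate p i) (enumerate p j)
  ; irrefl = irrefl G ∘ enumerate p
  }

open _≤ind_

≤ind⇒≤ : H ≤ind G → n H ≤ n G
≤ind⇒≤ e = injective⇒≤ (inj e)

≤ind-trans : H ≤ind G → G ≤ind K → H ≤ind K
≤ind-trans e f = record
  { emb    = emb f ∘ emb e
  ; inj    = inj e ∘ inj f
  ; adj-eq = λ i j → ≡.trans (adj-eq e i j) (adj-eq f (emb e i) (emb e j))
  }

≅⇒≤ind : G ≅ H → G ≤ind H
≅⇒≤ind iso = record
  { emb    = to
  ; inj    = λ {i} {j} eq → ≡.trans (≡.sym (from∘to i)) (≡.trans (cong from eq) (from∘to j))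
  ; adj-eq = _≅_.adj-eq iso
  }
  where open _≅_ iso using (to; from; from∘to)

image : H ≤ind G → Subset (n G)
image e = tabulate (λ x → does (any? (λ i → emb e i ≟ x)))

∈-image⁺ : (e : H ≤ind G) → ∀ i → emb e i ∈ image e
∈-image⁺ e i = lookup⇒[]= (emb e i) (image e)
  (≡.trans (lookup∘tabulate _ (emb e i)) (dec-true (any? (λ j → emb e j ≟ emb e i)) (i , refl)))

∈-image⁻ : (e : H ≤ind G) → ∀ {x} → x ∈ image e → ∃ λ i → emb e i ≡ x
∈-image⁻ e {x} x∈image = decidable-stable hit? λ no-hit →
  contradiction (≡.trans (≡.sym (dec-false hit? no-hit)) does-hit) λ ()
  where
  hit? = any? (λ i → emb e i ≟ x)
  does-hit : does hit? ≡ true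
  does-hit = ≡.trans (≡.sym (lookup∘tabulate _ x)) ([]=⇒lookup x∈image)

module _ (G : Graph) where

  []-≤ind : (p : Subset (n G)) → G [ p ] ≤ind G
  []-≤ind p = record { emb = enumerate p ; inj = enumerate-injective p ; adj-eq = λ _ _ → refl }

  corestrict : {p : Subset (n G)} (e : H ≤ind G) → (∀ i → emb e i ∈ p) → H ≤ind G [ p ]
  corestrict {p = p} e e∈p = record
    { emb    = index ∘ e∈p
    ; inj    = λ {i} {j} eq → inj e (≡.trans (≡.sym (enumerate-index (e∈p i)))
                                     (≡.trans (cong (enumerate p) eq) (enumerate-index (e∈p j))))
    ; adj-eq = λ i j → ≡.trans (adj-eq e i j)
                         (cong₂ (adj G) (≡.sym (enumerate-index (e∈p i))) (≡.sym (enumerate-index (e∈p j))))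
    }

  ⊆⇒[]≤ind : {p q : Subset (n G)} → p ⊆ q → G [ p ] ≤ind G [ q ]
  ⊆⇒[]≤ind {p = p} p⊆q = corestrict ([]-≤ind p) (p⊆q ∘ enumerate-∈ p)

  image-≤ind : (e : H ≤ind G) → G [ image e ] ≤ind H
  image-≤ind {H = H} e = record
    { emb    = preimage
    ; inj    = λ {k} {l} eq → enumerate-injective (image e)
                 (≡.trans (≡.sym (emb-preimage k)) (≡.trans (cong (emb e) eq) (emb-preimage l)))
    ; adj-eq = λ k l → ≡.trans (cong₂ (adj G) (≡.sym (emb-preimage k)) (≡.sym (emb-preimage l)))
                                (≡.sym (adj-eq e (preimage k) (preimage l)))
    }
    where
    preimage : Fin ∣ image e ∣ → Fin (n H)
    preimage k = proj₁ (∈-image⁻ e (enumerate-∈ (image e) k))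
    emb-preimage : ∀ k → emb e (preimage k) ≡ enumerate (image e) k
    emb-preimage k = proj₂ (∈-image⁻ e (enumerate-∈ (image e) k))

  induced-image : (X : Subset (n G)) → H ≤ind G [ X ] → ∃ λ Z → Z ⊆ X × H ≤ind G [ Z ] × G [ Z ] ≤ind H
  induced-image X e = image e′ , image⊆X , corestrict e′ (∈-image⁺ e′) , image-≤ind e′
    where
    e′ = ≤ind-trans e ([]-≤ind X)
    image⊆X : image e′ ⊆ X
    image⊆X x∈image with ∈-image⁻ e′ x∈image
    ... | i , refl = enumerate-∈ X (emb e i)

-- Forbidden induced subgraphs and apex classes

SmallForbidden : ℕ → GraphClass → Set
SmallForbidden m 𝒢 = ∀ F → Forbidden 𝒢 F → n F ≤ m

restrict : GraphClass → (G : Graph) → Subset (n G) → Set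
restrict 𝒢 G X = 𝒢 (G [ X ])

Apexₛ-⊤⇒Apex : (G : Graph) → Apexₛ r (restrict 𝒢 G) ⊤ → Apex r 𝒢 G
Apexₛ-⊤⇒Apex {r = r} G (Z , _ , 𝒢Z , ∣⊤∣≤) =
  G [ Z ] , 𝒢Z , []-≤ind G Z , subst (_≤ ∣ Z ∣ + r) (∣⊤∣≡n (n G)) ∣⊤∣≤

module _ (hereditary : Hereditary 𝒢) (G : Graph) where

  restrict-downClosed : DownClosed (restrict 𝒢 G)
  restrict-downClosed Y⊆X = hereditary (⊆⇒[]≤ind G Y⊆X)

  Apex⇒Apexₛ : (X : Subset (n G)) → Apex r 𝒢 (G [ X ]) → Apexₛ r (restrict 𝒢 G) X
  Apex⇒Apexₛ {r = r} X (H , 𝒢H , H≤G[X] , ∣X∣≤) with induced-image G X H≤G[X]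
  ... | Z , Z⊆X , H≤G[Z] , G[Z]≤H =
    Z , Z⊆X , hereditary G[Z]≤H 𝒢H , ≤-trans ∣X∣≤ (+-monoˡ-≤ r (≤ind⇒≤ H≤G[Z]))

  minimal⇒forbidden : (Y : Subset (n G)) → ¬ 𝒢 (G [ Y ]) → (∀ {v} → v ∈ Y → 𝒢 (G [ Y - v ])) →
                      Forbidden 𝒢 (G [ Y ])
  minimal⇒forbidden Y ¬𝒢Y minimal = ¬𝒢Y , proper
    where
    proper : ∀ H → H <ind G [ Y ] → 𝒢 H
    proper H (H≤G[Y] , nH<∣Y∣) with induced-image G Y H≤G[Y]
    ... | Z , Z⊆Y , H≤G[Z] , G[Z]≤H with ⊆⊎∃∉ Y Z
    ...   | inj₁ Y⊆Z = contradiction (≤-trans (p⊆q⇒∣p∣≤∣q∣ Y⊆Z) (≤ind⇒≤ G[Z]≤H)) (<⇒≱ nH<∣Y∣)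
    ...   | inj₂ (v , v∈Y , v∉Z) = hereditary H≤G[Z] (restrict-downClosed Z⊆Y-v (minimal v∈Y))
      where
      Z⊆Y-v : Z ⊆ Y - v
      Z⊆Y-v z∈Z = x∈p∧x≢y⇒x∈p-y (Z⊆Y z∈Z) λ { refl → v∉Z z∈Z }

  restrict-smallObstructions : SmallForbidden m 𝒢 → SmallObstructions m (restrict 𝒢 G)
  restrict-smallObstructions {m = m} bounded X ¬𝒢X =
    ¬¬-map forbiddenObstruction (minimal-counterexample X ¬𝒢X)
    where
    forbiddenObstruction : MinimalCounterexample (restrict 𝒢 G) X → Obstruction m (restrict 𝒢 G) X
    forbiddenObstruction (Y , Y⊆X , ¬𝒢Y , minimal) =
      obstruction Y Y⊆X (bounded (G [ Y ]) (minimal⇒forbidden Y ¬𝒢Y minimal)) ¬𝒢Y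

forbidden-size-bound : HasFiniteForbidden 𝒢 → ∃ λ m → SmallForbidden m 𝒢
forbidden-size-bound (L , covered) =
  max 0 (map n L) , λ F forbidden →
    v≤max⁺ 0 (map n L) (inj₂ (map⁺ (Any.map (≤ind⇒≤ ∘ ≅⇒≤ind) (covered F forbidden))))

apex-forbidden-size : Hereditary 𝒢 → SmallForbidden m 𝒢 → ∀ r → SmallForbidden (apexBound m r) (Apex r 𝒢)
apex-forbidden-size {𝒢 = 𝒢} {m = m} hereditary bounded r F (F∉ , proper∈) =
  decidable-stable (n F ≤? apexBound m r) λ F-large →
    obstructions ⊤ (F∉ ∘ Apexₛ-⊤⇒Apex F) λ (obstruction U _ ∣U∣≤ ¬ApexU) →
      ¬ApexU (Apex⇒Apexₛ hereditary F U (proper∈ (F [ U ]) ([]-≤ind F U , ≤-<-trans ∣U∣≤ (≰⇒> F-large))))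
  where
  obstructions : SmallObstructions (apexBound m r) (Apexₛ r (restrict 𝒢 F))
  obstructions =
    apex-obstructions (restrict-downClosed hereditary F) (restrict-smallObstructions hereditary F bounded) r

-- Graphs up to isomorphism, by size

fromMatrix : (k : ℕ) → Vec (Vec Bool k) k → Graph
fromMatrix k M = record { n = k ; adj = edge ; sym = edge-sym ; irrefl = edge-irrefl }
  where
  edge : Fin k → Fin k → Bool
  edge i j = if does (i ≟ j) then false else lookup (lookup M i) j ∧ lookup (lookup M j) i
  edge-sym : ∀ i j → edge i j ≡ edge j i
  edge-sym i j with i ≟ j | j ≟ i
  ... | yes _    | yes _    = refl
  ... | no _     | no _     = ∧-comm (lookup (lookup M i) j) (lookup (lookup M j) i)
  ... | yes refl | no j≢j   = contradiction refl j≢j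
  ... | no i≢j   | yes refl = contradiction refl i≢j
  edge-irrefl : ∀ i → edge i i ≡ false
  edge-irrefl i with i ≟ i
  ... | yes _   = refl
  ... | no i≢i  = contradiction refl i≢i

adjacencyMatrix : (G : Graph) → Vec (Vec Bool (n G)) (n G)
adjacencyMatrix G = tabulate λ i → tabulate (adj G i)

≅-fromMatrix : (G : Graph) → G ≅ fromMatrix (n G) (adjacencyMatrix G)
≅-fromMatrix G = record
  { to = id ; from = id ; from∘to = λ _ → refl ; to∘from = λ _ → refl ; adj-eq = same-adj }
  where
  entry : ∀ i j → lookup (lookup (adjacencyMatrix G) i) j ≡ adj G i j
  entry i j = ≡.trans (cong (λ row → lookup row j) (lookup∘tabulate _ i)) (lookup∘tabulate _ j)
  same-adj : ∀ i j → adj G i j ≡ adj (fromMatrix (n G) (adjacencyMatrix G)) i j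
  same-adj i j with i ≟ j
  ... | yes refl = irrefl G i
  ... | no _ = begin
    adj G i j                  ≡⟨ ∧-idem (adj G i j) ⟨
    adj G i j ∧ adj G i j      ≡⟨ cong (adj G i j ∧_) (sym G i j) ⟩
    adj G i j ∧ adj G j i      ≡⟨ cong₂ _∧_ (entry i j) (entry j i) ⟨
    lookup (lookup (adjacencyMatrix G) i) j ∧ lookup (lookup (adjacencyMatrix G) j) i ∎
    where open ≡.≡-Reasoning

vectors : {A : Set} → List A → (k : ℕ) → List (Vec A k)
vectors xs zero = [] ∷ []
vectors xs (suc k) = cartesianProductWith _∷_ xs (vectors xs k)

∈-vectors : {A : Set} {xs : List A} → (∀ a → a ∈ₗ xs) → (v : Vec A k) → v ∈ₗ vectors xs k
∈-vectors _ [] = here refl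
∈-vectors complete (a ∷ v) = ∈-cartesianProductWith⁺ _∷_ (complete a) (∈-vectors complete v)

∈-booleans : ∀ b → b ∈ₗ true ∷ false ∷ []
∈-booleans true = here refl
∈-booleans false = there (here refl)

graphsOfSize : ℕ → List Graph
graphsOfSize k = map (fromMatrix k) (vectors (vectors (true ∷ false ∷ []) k) k)

graphsUpTo : ℕ → List Graph
graphsUpTo b = concatMap graphsOfSize (upTo (suc b))

graphsOfSize-complete : (G : Graph) → Any (G ≅_) (graphsOfSize (n G))
graphsOfSize-complete G =
  map⁺ {f = fromMatrix (n G)} (lose (∈-vectors (∈-vectors ∈-booleans) (adjacencyMatrix G)) (≅-fromMatrix G))

graphsUpTo-complete : ∀ {b} (G : Graph) → n G ≤ b → Any (G ≅_) (graphsUpTo b)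
graphsUpTo-complete G nG≤b =
  concat⁺ (map⁺ {f = graphsOfSize} (lose (∈-upTo⁺ (s≤s nG≤b)) (graphsOfSize-complete G)))

corollary2p10 : (𝒢 : GraphClass) (r : ℕ) → Hereditary 𝒢 →
    HasFiniteForbidden 𝒢 → HasFiniteForbidden (Apex r 𝒢)
corollary2p10 𝒢 r hereditary finite with forbidden-size-bound finite
... | m , bounded =
  graphsUpTo (apexBound m r) ,
  λ F forbidden → graphsUpTo-complete F (apex-forbidden-size hereditary bounded r F forbidden)
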